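{- Let $s\in\mathbb{C}$. For all positive integers $m,n$, the operators $\frac{F_m}{[m]^s}$ and $\frac{F_n}{[n]^s}$ on $q\,\mathbb{C}[[q]]$ satisfy $$\frac{F_m}{[m]^s}\circ\frac{F_n}{[n]^s}=\frac{F_{mn}}{[mn]^s}.$$ In particular, $\frac{F_m}{[m]^s}$ and $\frac{F_n}{[n]^s}$ commute.
   Context: Work in the ring $\mathbb{C}[[q]]$ of formal power series in $q$, and let $q\,\mathbb{C}[[q]]$ be the subspace of series without constant term. For an integer $n\ge 1$, define the quantum number $[n]=\frac{q^n-1}{q-1}=1+q+\dots+q^{n-1}\in\mathbb{C}[[q]]$. For $s\in\mathbb{C}$, set $[n]^s=\exp(s\log[n])$; this is a well-defined formal power series because $[n]$ has constant term $1$. The formal Frobenius operator is $F_n(f)(q)=f(q^n)$. The operator $\frac{F_n}{[n]^s}$ is the linear map $f\mapsto [n]^{ -s}\,f(q^n)$: first apply $F_n$, then multiply by $[n]^{ -s}$ (where $[n]$ is the series in $q$, not in $q^n$). -}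

module Defs where

open import Level using (Level; _⊔_; suc)
open import Algebra.Bundles using (CommutativeRing)
open import Data.Nat as ℕ using (ℕ; zero; _<ᵇ_) renaming (suc to sucℕ)
open import Data.Nat.Divisibility using (_∣?_; divides)
open import Data.Bool using (if_then_else_)
open import Relation.Nullary using (¬_; yes; no)

module _ {c ℓ : Level} (R : CommutativeRing c ℓ) where
  open CommutativeRing R
  ι : ℕ → Carrier
  ι zero = 0#
  ι (sucℕ n) = 1# + ι n

-- A field of characteristic zero (standing in for ℂ, which agda-stdlib lacks).
record CharZeroField (c ℓ : Level) : Set (Level.suc (c ⊔ ℓ)) where
  field
    cring : CommutativeRing c ℓ
  open CommutativeRing cring public
  field
    1≉0     : ¬ (1# ≈ 0#)
    _⁻¹     : (x : Carrier) → ¬ (x ≈ 0#) → Carrier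
    ⁻¹-inv  : (x : Carrier) (p : ¬ (x ≈ 0#)) → x * (x ⁻¹) p ≈ 1#
    char0   : (n : ℕ) → ¬ (ι cring (sucℕ n) ≈ 0#)

module PowerSeries {c ℓ : Level} (K : CharZeroField c ℓ) where
  open CharZeroField K

  -- Formal power series: f N is the coefficient of q^N.
  PS : Set c
  PS = ℕ → Carrier

  _≈ₚ_ : PS → PS → Set ℓ
  f ≈ₚ g = (N : ℕ) → f N ≈ g N

  sumTo : ℕ → (ℕ → Carrier) → Carrier
  sumTo zero h = 0#
  sumTo (sucℕ n) h = sumTo n h + h n

  oneₚ : PS
  oneₚ zero = 1#
  oneₚ (sucℕ _) = 0#

  _*ₚ_ : PS → PS → PS
  (f *ₚ g) N = sumTo (sucℕ N) (λ i → f i * g (N ℕ.∸ i))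

  scaleₚ : Carrier → PS → PS
  scaleₚ a f N = a * f N

  powₚ : PS → ℕ → PS
  powₚ y zero = oneₚ
  powₚ y (sucℕ k) = y *ₚ powₚ y k

  invSuc : ℕ → Carrier
  invSuc k = (ι cring (sucℕ k) ⁻¹) (char0 k)

  invFact : ℕ → Carrier
  invFact zero = 1#
  invFact (sucℕ k) = invFact k * invSuc k

  sign : ℕ → Carrier
  sign zero = 1#
  sign (sucℕ j) = - sign j

  -- log(1 + y) = Σ_{k ≥ 1} (-1)^{k+1} y^k / k, for y without constant term
  -- (the coefficient of q^N only involves k ≤ N, so the truncation is exact).
  log1+ : PS → PS
  log1+ y N = sumTo (sucℕ N) term
    where
    term : ℕ → Carrier
    term zero = 0#
    term (sucℕ j) = sign j * invSuc j * powₚ y (sucℕ j) N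

  -- exp(y) = Σ_{k ≥ 0} y^k / k!, for y without constant term (exact truncation).
  expₚ : PS → PS
  expₚ y N = sumTo (sucℕ N) (λ k → invFact k * powₚ y k N)

  qnum : ℕ → PS
  qnum n N = if N <ᵇ n then 1# else 0#

  qnum-1 : ℕ → PS
  qnum-1 n zero = 0#
  qnum-1 n (sucℕ N) = qnum n (sucℕ N)

  qpow : ℕ → Carrier → PS
  qpow n s = expₚ (scaleₚ s (log1+ (qnum-1 n)))

  -- Frobenius F_n f (q) = f (q^n)
  Frob : ℕ → PS → PS
  Frob n f N with n ∣? N
  ... | yes (divides k _) = f k
  ... | no _ = 0#

  Op : ℕ → Carrier → PS → PS
  Op n s f = qpow n (- s) *ₚ Frob n f

  _∘ₚ_ : (PS → PS) → (PS → PS) → (PS → PS)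
  (A ∘ₚ B) f = A (B f)

  -- Equality of operators on q ℂ[[q]] (series with zero constant term).
  _≈op_ : (PS → PS) → (PS → PS) → Set (c ⊔ ℓ)
  A ≈op B = (f : PS) → f 0 ≈ 0# → A f ≈ₚ B f

{-# OPTIONS --safe #-}
module Submission where

-- With θ = q d/dq, the series G = [n]^t is characterised among series with constant term 1 by
-- [n]·θG = t·(θ[n])·G: this follows from θ exp(u) = exp(u)·θu and (1 + y)·θ log(1 + y) = θy, and
-- in characteristic zero it determines G coefficient by coefficient. The equation is multiplicative
-- in the pair ([n], G) and preserved by F_m, as θ F_m = m F_m θ. Hence [m]^t·F_m([n]^t) solves it
-- for [m]·F_m([n]) = [mn], so equals [mn]^t. Since F_m is a ring homomorphism with F_m F_n = F_mn,
-- this is the composition law for t = -s; commutation follows from mn = nm.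

open import Defs
open import Level using (Level)
open import Algebra.Bundles using (CommutativeSemigroup)
open import Data.Bool using (true; false; T)
open import Data.Unit using (tt)
open import Data.Nat as ℕ using (ℕ; zero; suc; _≤_; _<_; s≤s; _∸_; _<ᵇ_; NonZero)
import Data.Nat.Properties as ℕP
open import Data.Nat.Divisibility
  using (_∣_; _∣?_; divides; _∣0; ∣⇒≤; ∣m+n∣m⇒∣n; n∣m*n; ∣m∸n∣n⇒∣m; ∣-trans; m∣m*n)
open import Data.Nat.DivMod using (_/_; _%_; m≡m%n+[m/n]*n; m%n≡m∸m/n*n; m%n<n; m/n*n≤m; m<n*o⇒m/o<n)
open import Data.Nat.Induction using (<-rec)
open import Data.Empty using (⊥-elim)
open import Data.Product using (_×_; _,_)
open import Function using (_∘_)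
open import Relation.Binary.Bundles using (Setoid)
open import Relation.Binary.PropositionalEquality as P using (_≡_; _≢_)
open import Relation.Nullary using (¬_; Dec; yes; no)
import Algebra.Properties.CommutativeSemigroup as CommutativeSemigroupProperties
import Relation.Binary.Reasoning.Setoid as SetoidReasoning

module _ {c ℓ : Level} (K : CharZeroField c ℓ) where
  open CharZeroField K
  open PowerSeries K
  open import Algebra.Properties.Ring ring using (-‿distribˡ-*)
  open import Algebra.Properties.Group +-group using () renaming (∙-cancelˡ to +-cancelˡ)
  open import Algebra.Properties.Semiring.Mult semiring using (×-homo-+; ×1-homo-*) renaming (_×_ to _×′_)
  open CommutativeSemigroupProperties +-commutativeSemigroup using () renaming (interchange to +-interchange)
  open CommutativeSemigroupProperties *-commutativeSemigroup using () renaming (x∙yz≈y∙xz to x*yz≈y*xz)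
  module ≈-Reasoning = SetoidReasoning setoid

  ≡⇒≈ : ∀ {x y} → x ≡ y → x ≈ y
  ≡⇒≈ P.refl = refl

  ι≈×1# : ∀ n → ι cring n ≈ n ×′ 1#
  ι≈×1# zero = refl
  ι≈×1# (suc n) = +-congˡ (ι≈×1# n)

  -- Finite sums

  sumTo-cong : ∀ n {f g : ℕ → Carrier} → (∀ i → i < n → f i ≈ g i) → sumTo n f ≈ sumTo n g
  sumTo-cong zero f≈g = refl
  sumTo-cong (suc n) f≈g = +-cong (sumTo-cong n (λ i i<n → f≈g i (ℕP.m<n⇒m<1+n i<n))) (f≈g n ℕP.≤-refl)

  sumTo-zero : ∀ n {f : ℕ → Carrier} → (∀ i → i < n → f i ≈ 0#) → sumTo n f ≈ 0#
  sumTo-zero n f≈0 = trans (sumTo-cong n f≈0) (sumTo-0# n)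
    where
    sumTo-0# : ∀ n → sumTo n (λ _ → 0#) ≈ 0#
    sumTo-0# zero = refl
    sumTo-0# (suc n) = trans (+-identityʳ _) (sumTo-0# n)

  sumTo-+ : ∀ n (f g : ℕ → Carrier) → sumTo n (λ i → f i + g i) ≈ sumTo n f + sumTo n g
  sumTo-+ zero f g = sym (+-identityˡ 0#)
  sumTo-+ (suc n) f g = trans (+-congʳ (sumTo-+ n f g)) (+-interchange _ _ _ _)

  sumTo-*ˡ : ∀ n a (f : ℕ → Carrier) → a * sumTo n f ≈ sumTo n (λ i → a * f i)
  sumTo-*ˡ zero a f = zeroʳ a
  sumTo-*ˡ (suc n) a f = trans (distribˡ a _ _) (+-congʳ (sumTo-*ˡ n a f))

  sumTo-*ʳ : ∀ n a (f : ℕ → Carrier) → sumTo n f * a ≈ sumTo n (λ i → f i * a)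
  sumTo-*ʳ zero a f = zeroˡ a
  sumTo-*ʳ (suc n) a f = trans (distribʳ a _ _) (+-congʳ (sumTo-*ʳ n a f))

  sumTo-head : ∀ n (f : ℕ → Carrier) → sumTo (suc n) f ≈ f 0 + sumTo n (f ∘ suc)
  sumTo-head zero f = trans (+-identityˡ _) (sym (+-identityʳ _))
  sumTo-head (suc n) f = trans (+-congʳ (sumTo-head n f)) (+-assoc _ _ _)

  sumTo-split : ∀ a b (f : ℕ → Carrier) → sumTo (a ℕ.+ b) f ≈ sumTo a f + sumTo b (λ i → f (a ℕ.+ i))
  sumTo-split a zero f = trans (≡⇒≈ (P.cong (λ k → sumTo k f) (ℕP.+-identityʳ a))) (sym (+-identityʳ _))
  sumTo-split a (suc b) f = begin
    sumTo (a ℕ.+ suc b) f                                      ≡⟨ P.cong (λ k → sumTo k f) (ℕP.+-suc a b) ⟩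
    sumTo (a ℕ.+ b) f + f (a ℕ.+ b)                            ≈⟨ +-congʳ (sumTo-split a b f) ⟩
    (sumTo a f + sumTo b (λ i → f (a ℕ.+ i))) + f (a ℕ.+ b)   ≈⟨ +-assoc _ _ _ ⟩
    sumTo a f + sumTo (suc b) (λ i → f (a ℕ.+ i))              ∎
    where open ≈-Reasoning

  sumTo-extend : ∀ {a b} (f : ℕ → Carrier) → a ≤ b → (∀ i → a ≤ i → i < b → f i ≈ 0#) →
                 sumTo b f ≈ sumTo a f
  sumTo-extend {a} f a≤b tail≈0 with ℕP.m≤n⇒∃[o]m+o≡n a≤b
  ... | k , P.refl = begin
    sumTo (a ℕ.+ k) f                          ≈⟨ sumTo-split a k f ⟩
    sumTo a f + sumTo k (λ i → f (a ℕ.+ i))    ≈⟨ +-congˡ (sumTo-zero k λ i i<k →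
                                                    tail≈0 (a ℕ.+ i) (ℕP.m≤m+n a i) (ℕP.+-monoʳ-< a i<k)) ⟩
    sumTo a f + 0#                             ≈⟨ +-identityʳ _ ⟩
    sumTo a f                                  ∎
    where open ≈-Reasoning

  sumTo-single : ∀ n k (f : ℕ → Carrier) → k < n → (∀ i → i < n → i ≢ k → f i ≈ 0#) → sumTo n f ≈ f k
  sumTo-single (suc n) k f k<1+n others≈0 with k ℕP.≟ n
  ... | yes P.refl = trans (+-congʳ (sumTo-zero n λ i i<n → others≈0 i (ℕP.m<n⇒m<1+n i<n) (ℕP.<⇒≢ i<n)))
                           (+-identityˡ _)
  ... | no k≢n = trans (+-congˡ (others≈0 n ℕP.≤-refl (k≢n ∘ P.sym)))
                       (trans (+-identityʳ _)
                              (sumTo-single n k f (ℕP.≤∧≢⇒< (ℕP.≤-pred k<1+n) k≢n)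
                                            (λ i i<n → others≈0 i (ℕP.m<n⇒m<1+n i<n))))

  sumTo-reverse : ∀ n (f : ℕ → Carrier) → sumTo n f ≈ sumTo n (λ i → f (n ∸ suc i))
  sumTo-reverse zero f = refl
  sumTo-reverse (suc n) f = begin
    sumTo n f + f n                           ≈⟨ +-congʳ (sumTo-reverse n f) ⟩
    sumTo n (λ i → f (n ∸ suc i)) + f n       ≈⟨ +-comm _ _ ⟩
    f n + sumTo n (λ i → f (n ∸ suc i))       ≈⟨ sumTo-head n (λ i → f (n ∸ i)) ⟨
    sumTo (suc n) (λ i → f (n ∸ i))           ∎
    where open ≈-Reasoning

  sumTo-swap : ∀ a b (h : ℕ → ℕ → Carrier) →
               sumTo a (λ i → sumTo b (h i)) ≈ sumTo b (λ j → sumTo a (λ i → h i j))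
  sumTo-swap zero b h = sym (sumTo-zero b (λ _ _ → refl))
  sumTo-swap (suc a) b h = begin
    sumTo a (λ i → sumTo b (h i)) + sumTo b (h a)            ≈⟨ +-congʳ (sumTo-swap a b h) ⟩
    sumTo b (λ j → sumTo a (λ i → h i j)) + sumTo b (h a)    ≈⟨ sumTo-+ b _ _ ⟨
    sumTo b (λ j → sumTo (suc a) (λ i → h i j))              ∎
    where open ≈-Reasoning

  sumTo-triangle : ∀ N (h : ℕ → ℕ → Carrier) →
                   sumTo (suc N) (λ i → sumTo (suc i) (λ j → h j (i ∸ j))) ≈
                   sumTo (suc N) (λ j → sumTo (suc (N ∸ j)) (h j))
  sumTo-triangle zero h = refl
  sumTo-triangle (suc N) h = begin
    sumTo (suc N) (λ i → sumTo (suc i) (λ j → h j (i ∸ j))) + sumTo (2 ℕ.+ N) (λ j → h j (suc N ∸ j))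
      ≈⟨ +-congʳ (sumTo-triangle N h) ⟩
    Previous + (sumTo (suc N) (λ j → h j (suc N ∸ j)) + h (suc N) (N ∸ N))
      ≈⟨ +-assoc _ _ _ ⟨
    (Previous + sumTo (suc N) (λ j → h j (suc N ∸ j))) + h (suc N) (N ∸ N)
      ≈⟨ +-congʳ (sumTo-+ (suc N) _ _) ⟨
    sumTo (suc N) (λ j → sumTo (suc (N ∸ j)) (h j) + h j (suc N ∸ j)) + h (suc N) (N ∸ N)
      ≈⟨ +-cong (sumTo-cong (suc N) (λ j j≤N → grow j (ℕP.≤-pred j≤N))) corner ⟩
    sumTo (2 ℕ.+ N) (λ j → sumTo (suc (suc N ∸ j)) (h j)) ∎
    where
    open ≈-Reasoning
    Previous = sumTo (suc N) (λ j → sumTo (suc (N ∸ j)) (h j))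
    grow : ∀ j → j ≤ N → sumTo (suc (N ∸ j)) (h j) + h j (suc N ∸ j) ≈ sumTo (suc (suc N ∸ j)) (h j)
    grow j j≤N rewrite ℕP.+-∸-assoc 1 j≤N = refl
    corner : h (suc N) (N ∸ N) ≈ sumTo (suc (N ∸ N)) (h (suc N))
    corner rewrite ℕP.n∸n≡0 N = sym (+-identityˡ _)

  module _ (m : ℕ) .{{_ : NonZero m}} {g : ℕ → Carrier} (g≈0 : ∀ i → ¬ (m ∣ i) → g i ≈ 0#) where

    sumTo-block : ∀ b r → m ∣ b → r < m → sumTo (suc r) (λ i → g (b ℕ.+ i)) ≈ g b
    sumTo-block b r m∣b r<m = begin
      sumTo (suc r) (λ i → g (b ℕ.+ i))             ≈⟨ sumTo-head r _ ⟩
      g (b ℕ.+ 0) + sumTo r (λ i → g (b ℕ.+ suc i)) ≈⟨ +-cong (≡⇒≈ (P.cong g (ℕP.+-identityʳ b)))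
                                                              (sumTo-zero r λ i i<r → g≈0 _ (m∤ i i<r)) ⟩
      g b + 0#                                      ≈⟨ +-identityʳ _ ⟩
      g b                                           ∎
      where
      open ≈-Reasoning
      m∤ : ∀ i → i < r → ¬ (m ∣ b ℕ.+ suc i)
      m∤ i i<r m∣ = ℕP.<⇒≱ (ℕP.≤-<-trans i<r r<m) (∣⇒≤ (∣m+n∣m⇒∣n m∣ m∣b))

    sumTo-multiples : ∀ k r → r < m → sumTo (suc (k ℕ.* m ℕ.+ r)) g ≈ sumTo (suc k) (λ j → g (j ℕ.* m))
    sumTo-multiples zero r r<m = trans (sumTo-block 0 r (m ∣0) r<m) (sym (+-identityˡ _))
    sumTo-multiples (suc k) r r<m = begin
      sumTo (suc (suc k ℕ.* m ℕ.+ r)) g                                      ≡⟨ P.cong (λ n → sumTo n g) (P.sym (ℕP.+-suc _ r)) ⟩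
      sumTo (suc k ℕ.* m ℕ.+ suc r) g                                        ≈⟨ sumTo-split (suc k ℕ.* m) (suc r) g ⟩
      sumTo (suc k ℕ.* m) g + sumTo (suc r) (λ i → g (suc k ℕ.* m ℕ.+ i))   ≈⟨ +-cong earlier (sumTo-block _ r (n∣m*n (suc k)) r<m) ⟩
      sumTo (suc k) (λ j → g (j ℕ.* m)) + g (suc k ℕ.* m)                    ∎
      where
      open ≈-Reasoning
      [1+k]m≡1+[km+pred[m]] : suc k ℕ.* m ≡ suc (k ℕ.* m ℕ.+ ℕ.pred m)
      [1+k]m≡1+[km+pred[m]] = P.trans (ℕP.+-comm m (k ℕ.* m))
                      (P.trans (P.cong (k ℕ.* m ℕ.+_) (P.sym (ℕP.suc-pred m))) (ℕP.+-suc _ _))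
      earlier : sumTo (suc k ℕ.* m) g ≈ sumTo (suc k) (λ j → g (j ℕ.* m))
      earlier = trans (≡⇒≈ (P.cong (λ n → sumTo n g) [1+k]m≡1+[km+pred[m]]))
                      (sumTo-multiples k (ℕ.pred m) (ℕP.m≤pred[n]⇒suc[m]≤n ℕP.≤-refl))

  sumTo-alternating-telescope : ∀ n (a : ℕ → Carrier) →
                                sumTo n (λ j → sign j * (a j + a (suc j))) + sign n * a n ≈ a 0
  sumTo-alternating-telescope zero a = trans (+-identityˡ _) (*-identityˡ _)
  sumTo-alternating-telescope (suc n) a = begin
    (S + sign n * (a n + a (suc n))) + - sign n * a (suc n)   ≈⟨ +-assoc _ _ _ ⟩
    S + (sign n * (a n + a (suc n)) + - sign n * a (suc n))   ≈⟨ +-congˡ (+-cong (distribˡ _ _ _) (sym (-‿distribˡ-* _ _))) ⟩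
    S + ((sign n * a n + sign n * a (suc n)) + - (sign n * a (suc n)))
                                                              ≈⟨ +-congˡ (+-assoc _ _ _) ⟩
    S + (sign n * a n + (sign n * a (suc n) + - (sign n * a (suc n))))
                                                              ≈⟨ +-congˡ (+-congˡ (-‿inverseʳ _)) ⟩
    S + (sign n * a n + 0#)                                   ≈⟨ +-congˡ (+-identityʳ _) ⟩
    S + sign n * a n                                          ≈⟨ sumTo-alternating-telescope n a ⟩
    a 0                                                       ∎
    where
    open ≈-Reasoning
    S = sumTo n (λ j → sign j * (a j + a (suc j)))

  -- The ring of formal power series

  infixl 6 _+ₚ_
  _+ₚ_ : PS → PS → PS
  (f +ₚ g) N = f N + g N

  *ₚ-cong : ∀ {f f′ g g′} → f ≈ₚ f′ → g ≈ₚ g′ → (f *ₚ g) ≈ₚ (f′ *ₚ g′)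
  *ₚ-cong f≈f′ g≈g′ N = sumTo-cong (suc N) (λ i _ → *-cong (f≈f′ i) (g≈g′ (N ∸ i)))

  *ₚ-comm : ∀ f g → (f *ₚ g) ≈ₚ (g *ₚ f)
  *ₚ-comm f g N = begin
    sumTo (suc N) (λ i → f i * g (N ∸ i))              ≈⟨ sumTo-reverse (suc N) _ ⟩
    sumTo (suc N) (λ i → f (N ∸ i) * g (N ∸ (N ∸ i)))  ≈⟨ sumTo-cong (suc N) (λ i i≤N →
                                                             trans (*-comm _ _) (*-congʳ (≡⇒≈ (P.cong g (ℕP.m∸[m∸n]≡n (ℕP.≤-pred i≤N)))))) ⟩
    sumTo (suc N) (λ i → g i * f (N ∸ i))              ∎
    where open ≈-Reasoning

  *ₚ-assoc : ∀ f g h → ((f *ₚ g) *ₚ h) ≈ₚ (f *ₚ (g *ₚ h))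
  *ₚ-assoc f g h N = begin
    sumTo (suc N) (λ i → sumTo (suc i) (λ j → f j * g (i ∸ j)) * h (N ∸ i))
      ≈⟨ sumTo-cong (suc N) (λ i _ → sumTo-*ʳ (suc i) _ _) ⟩
    sumTo (suc N) (λ i → sumTo (suc i) (λ j → f j * g (i ∸ j) * h (N ∸ i)))
      ≈⟨ sumTo-cong (suc N) (λ i _ → sumTo-cong (suc i) λ j j≤i →
           *-congˡ (≡⇒≈ (P.cong h (∸-reassoc i j (ℕP.≤-pred j≤i))))) ⟩
    sumTo (suc N) (λ i → sumTo (suc i) (λ j → f j * g (i ∸ j) * h (N ∸ j ∸ (i ∸ j))))
      ≈⟨ sumTo-triangle N (λ j k → f j * g k * h (N ∸ j ∸ k)) ⟩
    sumTo (suc N) (λ j → sumTo (suc (N ∸ j)) (λ k → f j * g k * h (N ∸ j ∸ k)))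
      ≈⟨ sumTo-cong (suc N) (λ j _ → trans (sumTo-cong (suc (N ∸ j)) (λ k _ → *-assoc _ _ _))
                                           (sym (sumTo-*ˡ (suc (N ∸ j)) _ _))) ⟩
    sumTo (suc N) (λ j → f j * sumTo (suc (N ∸ j)) (λ k → g k * h (N ∸ j ∸ k))) ∎
    where
    open ≈-Reasoning
    ∸-reassoc : ∀ i j → j ≤ i → N ∸ i ≡ N ∸ j ∸ (i ∸ j)
    ∸-reassoc i j j≤i = P.trans (P.cong (N ∸_) (P.sym (ℕP.m+[n∸m]≡n j≤i))) (P.sym (ℕP.∸-+-assoc N j (i ∸ j)))

  *ₚ-identityˡ : ∀ f → (oneₚ *ₚ f) ≈ₚ f
  *ₚ-identityˡ f N = begin
    sumTo (suc N) (λ i → oneₚ i * f (N ∸ i))          ≈⟨ sumTo-head N _ ⟩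
    1# * f N + sumTo N (λ i → 0# * f (N ∸ suc i))     ≈⟨ +-cong (*-identityˡ _) (sumTo-zero N (λ i _ → zeroˡ _)) ⟩
    f N + 0#                                          ≈⟨ +-identityʳ _ ⟩
    f N                                               ∎
    where open ≈-Reasoning

  *ₚ-distribˡ : ∀ f g h → (f *ₚ (g +ₚ h)) ≈ₚ ((f *ₚ g) +ₚ (f *ₚ h))
  *ₚ-distribˡ f g h N = trans (sumTo-cong (suc N) (λ i _ → distribˡ _ _ _)) (sumTo-+ (suc N) _ _)

  *ₚ-distribʳ : ∀ f g h → ((g +ₚ h) *ₚ f) ≈ₚ ((g *ₚ f) +ₚ (h *ₚ f))
  *ₚ-distribʳ f g h N = trans (sumTo-cong (suc N) (λ i _ → distribʳ _ _ _)) (sumTo-+ (suc N) _ _)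

  ≈ₚ-setoid : Setoid c ℓ
  ≈ₚ-setoid = record
    { Carrier = PS
    ; _≈_ = _≈ₚ_
    ; isEquivalence = record
      { refl = λ _ → refl
      ; sym = λ f≈g N → sym (f≈g N)
      ; trans = λ f≈g g≈h N → trans (f≈g N) (g≈h N)
      }
    }

  module ≈ₚ-Reasoning = SetoidReasoning ≈ₚ-setoid
  open Setoid ≈ₚ-setoid using () renaming (refl to ≈ₚ-refl; sym to ≈ₚ-sym; trans to ≈ₚ-trans)

  *ₚ-commutativeSemigroup : CommutativeSemigroup c ℓ
  *ₚ-commutativeSemigroup = record
    { _∙_ = _*ₚ_
    ; isCommutativeSemigroup = record
      { isSemigroup = record
        { isMagma = record { isEquivalence = Setoid.isEquivalence ≈ₚ-setoid ; ∙-cong = *ₚ-cong }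
        ; assoc = *ₚ-assoc
        }
      ; comm = *ₚ-comm
      }
    }

  open CommutativeSemigroupProperties *ₚ-commutativeSemigroup using ()
    renaming (interchange to *ₚ-interchange; x∙yz≈y∙xz to x*ₚyz≈y*ₚxz)

  *ₚ-congˡ : ∀ f {g g′} → g ≈ₚ g′ → (f *ₚ g) ≈ₚ (f *ₚ g′)
  *ₚ-congˡ f = *ₚ-cong {f} ≈ₚ-refl

  *ₚ-congʳ : ∀ g {f f′} → f ≈ₚ f′ → (f *ₚ g) ≈ₚ (f′ *ₚ g)
  *ₚ-congʳ g f≈f′ = *ₚ-cong f≈f′ (≈ₚ-refl {g})

  *ₚ-identityʳ : ∀ f → (f *ₚ oneₚ) ≈ₚ f
  *ₚ-identityʳ f = ≈ₚ-trans (*ₚ-comm f oneₚ) (*ₚ-identityˡ f)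

  +ₚ-cong : ∀ {f f′ g g′} → f ≈ₚ f′ → g ≈ₚ g′ → (f +ₚ g) ≈ₚ (f′ +ₚ g′)
  +ₚ-cong f≈f′ g≈g′ N = +-cong (f≈f′ N) (g≈g′ N)

  +ₚ-congˡ : ∀ f {g g′} → g ≈ₚ g′ → (f +ₚ g) ≈ₚ (f +ₚ g′)
  +ₚ-congˡ f g≈g′ N = +-congˡ (g≈g′ N)

  scaleₚ-cong : ∀ a {f g} → f ≈ₚ g → scaleₚ a f ≈ₚ scaleₚ a g
  scaleₚ-cong a f≈g N = *-congˡ (f≈g N)

  scaleₚ-+ₚ : ∀ a f g → scaleₚ a (f +ₚ g) ≈ₚ (scaleₚ a f +ₚ scaleₚ a g)
  scaleₚ-+ₚ a f g N = distribˡ _ _ _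

  scaleₚ-*ₚ : ∀ a f g → (scaleₚ a f *ₚ g) ≈ₚ scaleₚ a (f *ₚ g)
  scaleₚ-*ₚ a f g N = trans (sumTo-cong (suc N) (λ i _ → *-assoc _ _ _)) (sym (sumTo-*ˡ (suc N) a _))

  *ₚ-scaleₚ : ∀ a f g → (f *ₚ scaleₚ a g) ≈ₚ scaleₚ a (f *ₚ g)
  *ₚ-scaleₚ a f g = ≈ₚ-trans (*ₚ-comm f (scaleₚ a g)) (≈ₚ-trans (scaleₚ-*ₚ a g f) (scaleₚ-cong a (*ₚ-comm g f)))

  ι-+ : ∀ a b → ι cring (a ℕ.+ b) ≈ ι cring a + ι cring b
  ι-+ a b = trans (ι≈×1# (a ℕ.+ b)) (trans (×-homo-+ 1# a b) (sym (+-cong (ι≈×1# a) (ι≈×1# b))))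

  ι-* : ∀ a b → ι cring (a ℕ.* b) ≈ ι cring a * ι cring b
  ι-* a b = trans (ι≈×1# (a ℕ.* b)) (trans (×1-homo-* a b) (sym (*-cong (ι≈×1# a) (ι≈×1# b))))

  -- The Euler operator θ = q d/dq.
  θ : PS → PS
  θ f N = ι cring N * f N

  θ-cong : ∀ {f g} → f ≈ₚ g → θ f ≈ₚ θ g
  θ-cong f≈g N = *-congˡ (f≈g N)

  θ-oneₚ : ∀ N → θ oneₚ N ≈ 0#
  θ-oneₚ zero = zeroˡ _
  θ-oneₚ (suc N) = zeroʳ _

  θ-scaleₚ : ∀ a f → θ (scaleₚ a f) ≈ₚ scaleₚ a (θ f)
  θ-scaleₚ a f N = x*yz≈y*xz _ _ _

  θ-*ₚ : ∀ f g → θ (f *ₚ g) ≈ₚ ((θ f *ₚ g) +ₚ (f *ₚ θ g))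
  θ-*ₚ f g N = begin
    ι cring N * sumTo (suc N) (λ i → f i * g (N ∸ i))       ≈⟨ sumTo-*ˡ (suc N) _ _ ⟩
    sumTo (suc N) (λ i → ι cring N * (f i * g (N ∸ i)))     ≈⟨ sumTo-cong (suc N) (λ i i≤N → Leibniz (ℕP.≤-pred i≤N)) ⟩
    sumTo (suc N) (λ i → θ f i * g (N ∸ i) + f i * θ g (N ∸ i)) ≈⟨ sumTo-+ (suc N) _ _ ⟩
    ((θ f *ₚ g) +ₚ (f *ₚ θ g)) N                            ∎
    where
    open ≈-Reasoning
    Leibniz : ∀ {i} → i ≤ N → ι cring N * (f i * g (N ∸ i)) ≈ θ f i * g (N ∸ i) + f i * θ g (N ∸ i)
    Leibniz {i} i≤N = begin
      ι cring N * (f i * g (N ∸ i))                             ≈⟨ *-congʳ (trans (≡⇒≈ (P.cong (ι cring) (P.sym (ℕP.m+[n∸m]≡n i≤N))))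
                                                                                  (ι-+ i (N ∸ i))) ⟩
      (ι cring i + ι cring (N ∸ i)) * (f i * g (N ∸ i))         ≈⟨ distribʳ _ _ _ ⟩
      ι cring i * (f i * g (N ∸ i)) + ι cring (N ∸ i) * (f i * g (N ∸ i))
                                                                ≈⟨ +-cong (sym (*-assoc _ _ _)) (x*yz≈y*xz _ _ _) ⟩
      θ f i * g (N ∸ i) + f i * θ g (N ∸ i)                     ∎

  θ-powₚ : ∀ y k → θ (powₚ y (suc k)) ≈ₚ scaleₚ (ι cring (suc k)) (powₚ y k *ₚ θ y)
  θ-powₚ y zero = begin
    θ (y *ₚ oneₚ)                    ≈⟨ θ-cong (*ₚ-identityʳ y) ⟩
    θ y                              ≈⟨ *ₚ-identityˡ (θ y) ⟨
    oneₚ *ₚ θ y                      ≈⟨ (λ N → sym (trans (*-congʳ (+-identityʳ 1#)) (*-identityˡ _))) ⟩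
    scaleₚ (1# + 0#) (oneₚ *ₚ θ y)   ∎
    where open ≈ₚ-Reasoning
  θ-powₚ y (suc k) = begin
    θ (y *ₚ Y)                                           ≈⟨ θ-*ₚ y Y ⟩
    (θ y *ₚ Y) +ₚ (y *ₚ θ Y)                             ≈⟨ +ₚ-cong (*ₚ-comm (θ y) Y) (*ₚ-congˡ y (θ-powₚ y k)) ⟩
    (Y *ₚ θ y) +ₚ (y *ₚ scaleₚ n (powₚ y k *ₚ θ y))      ≈⟨ +ₚ-congˡ (Y *ₚ θ y) (*ₚ-scaleₚ n y (powₚ y k *ₚ θ y)) ⟩
    (Y *ₚ θ y) +ₚ scaleₚ n (y *ₚ (powₚ y k *ₚ θ y))      ≈⟨ +ₚ-congˡ (Y *ₚ θ y) (scaleₚ-cong n (*ₚ-assoc y (powₚ y k) (θ y))) ⟨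
    (Y *ₚ θ y) +ₚ scaleₚ n (Y *ₚ θ y)                    ≈⟨ (λ N → sym (trans (distribʳ _ _ _) (+-congʳ (*-identityˡ _)))) ⟩
    scaleₚ (1# + n) (Y *ₚ θ y)                           ∎
    where
    open ≈ₚ-Reasoning
    n = ι cring (suc k)
    Y = powₚ y (suc k)

  VanishesBelow : ℕ → PS → Set ℓ
  VanishesBelow k f = ∀ N → N < k → f N ≈ 0#

  vanishesBelow-*ₚ : ∀ {a b f g} → VanishesBelow a f → VanishesBelow b g → VanishesBelow (a ℕ.+ b) (f *ₚ g)
  vanishesBelow-*ₚ {a} {b} {f} {g} f≈0 g≈0 N N<a+b = sumTo-zero (suc N) term≈0
    where
    term≈0 : ∀ i → i < suc N → f i * g (N ∸ i) ≈ 0#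
    term≈0 i i≤N with i ℕP.<? a
    ... | yes i<a = trans (*-congʳ (f≈0 i i<a)) (zeroˡ _)
    ... | no i≮a = trans (*-congˡ (g≈0 (N ∸ i) N∸i<b)) (zeroʳ _)
      where
      N∸i<b : N ∸ i < b
      N∸i<b = ℕP.<-≤-trans (ℕP.∸-monoˡ-< N<a+b (ℕP.≤-pred i≤N))
                (ℕP.≤-trans (ℕP.∸-monoʳ-≤ (a ℕ.+ b) (ℕP.≮⇒≥ i≮a)) (ℕP.≤-reflexive (ℕP.m+n∸m≡n a b)))

  vanishesBelow-mono : ∀ {a b f} → b ≤ a → VanishesBelow a f → VanishesBelow b f
  vanishesBelow-mono b≤a f≈0 N N<b = f≈0 N (ℕP.<-≤-trans N<b b≤a)

  vanishesBelow-powₚ : ∀ {y} → VanishesBelow 1 y → ∀ k → VanishesBelow k (powₚ y k)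
  vanishesBelow-powₚ y≈0 zero N ()
  vanishesBelow-powₚ y≈0 (suc k) = vanishesBelow-*ₚ y≈0 (vanishesBelow-powₚ y≈0 k)

  vanishesBelow-θ : ∀ f → VanishesBelow 1 (θ f)
  vanishesBelow-θ f zero _ = zeroˡ _
  vanishesBelow-θ f (suc N) (s≤s ())

  vanishesBelow-scaleₚ : ∀ a {k f} → VanishesBelow k f → VanishesBelow k (scaleₚ a f)
  vanishesBelow-scaleₚ a f≈0 N N<k = trans (*-congˡ (f≈0 N N<k)) (zeroʳ a)

  vanishesBelow-powₚ-θ : ∀ {y} → VanishesBelow 1 y → ∀ j → VanishesBelow (suc j) (powₚ y j *ₚ θ y)
  vanishesBelow-powₚ-θ {y} y≈0 j = P.subst (λ k → VanishesBelow k (powₚ y j *ₚ θ y)) (ℕP.+-comm j 1)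
                                     (vanishesBelow-*ₚ (vanishesBelow-powₚ y≈0 j) (vanishesBelow-θ y))

  -- Truncating at k ≤ N gives the true sum of the family when h k vanishes below k.
  Σₚ : (ℕ → PS) → PS
  Σₚ h N = sumTo (suc N) (λ k → h k N)

  Σₚ-*ₚ : ∀ h g → (∀ k → VanishesBelow k (h k)) → (Σₚ h *ₚ g) ≈ₚ Σₚ (λ k → h k *ₚ g)
  Σₚ-*ₚ h g h≈0 N = begin
    sumTo (suc N) (λ i → sumTo (suc i) (λ k → h k i) * g (N ∸ i))    ≈⟨ sumTo-cong (suc N) (λ i _ → sumTo-*ʳ (suc i) _ _) ⟩
    sumTo (suc N) (λ i → sumTo (suc i) (λ k → h k i * g (N ∸ i)))    ≈⟨ sumTo-cong (suc N) (λ i i≤N → sym (sumTo-extend _ i≤N λ k i<k _ →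
                                                                           trans (*-congʳ (h≈0 k i i<k)) (zeroˡ _))) ⟩
    sumTo (suc N) (λ i → sumTo (suc N) (λ k → h k i * g (N ∸ i)))    ≈⟨ sumTo-swap (suc N) (suc N) _ ⟩
    Σₚ (λ k → h k *ₚ g) N                                            ∎
    where open ≈-Reasoning

  -- exp and log

  invSuc-cancel : ∀ j x → invSuc j * (ι cring (suc j) * x) ≈ x
  invSuc-cancel j x = begin
    invSuc j * (ι cring (suc j) * x)   ≈⟨ *-assoc _ _ _ ⟨
    (invSuc j * ι cring (suc j)) * x   ≈⟨ *-congʳ (trans (*-comm _ _) (⁻¹-inv _ (char0 j))) ⟩
    1# * x                             ≈⟨ *-identityˡ x ⟩
    x                                  ∎
    where open ≈-Reasoning

  θ-expₚ : ∀ {u} → VanishesBelow 1 u → θ (expₚ u) ≈ₚ (expₚ u *ₚ θ u)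
  θ-expₚ {u} u≈0 N = begin
    θ (expₚ u) N                                                        ≈⟨ sumTo-*ˡ (suc N) _ _ ⟩
    sumTo (suc N) (λ k → ι cring N * (invFact k * powₚ u k N))          ≈⟨ sumTo-head N _ ⟩
    ι cring N * (1# * oneₚ N) + sumTo N (λ j → ι cring N * (invFact (suc j) * powₚ u (suc j) N))
                                                                        ≈⟨ +-cong constant≈0 (sumTo-cong N (λ j _ → shift j)) ⟩
    0# + sumTo N (λ j → invFact j * (powₚ u j *ₚ θ u) N)                ≈⟨ +-identityˡ _ ⟩
    sumTo N (λ j → invFact j * (powₚ u j *ₚ θ u) N)                     ≈⟨ sumTo-extend _ (ℕP.n≤1+n N) top≈0 ⟨
    sumTo (suc N) (λ j → invFact j * (powₚ u j *ₚ θ u) N)               ≈⟨ sumTo-cong (suc N) (λ j _ → scaleₚ-*ₚ (invFact j) (powₚ u j) (θ u) N) ⟨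
    Σₚ (λ j → scaleₚ (invFact j) (powₚ u j) *ₚ θ u) N                  ≈⟨ Σₚ-*ₚ (λ j → scaleₚ (invFact j) (powₚ u j)) (θ u)
                                                                             (λ j → vanishesBelow-scaleₚ _ (vanishesBelow-powₚ u≈0 j)) N ⟨
    (expₚ u *ₚ θ u) N                                                   ∎
    where
    open ≈-Reasoning
    constant≈0 : ι cring N * (1# * oneₚ N) ≈ 0#
    constant≈0 = trans (x*yz≈y*xz _ _ _) (trans (*-congˡ (θ-oneₚ N)) (zeroʳ _))
    shift : ∀ j → ι cring N * (invFact (suc j) * powₚ u (suc j) N) ≈ invFact j * (powₚ u j *ₚ θ u) N
    shift j = begin
      ι cring N * ((invFact j * invSuc j) * powₚ u (suc j) N)       ≈⟨ x*yz≈y*xz _ _ _ ⟩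
      (invFact j * invSuc j) * θ (powₚ u (suc j)) N                 ≈⟨ *-congˡ (θ-powₚ u j N) ⟩
      (invFact j * invSuc j) * (ι cring (suc j) * (powₚ u j *ₚ θ u) N) ≈⟨ *-assoc _ _ _ ⟩
      invFact j * (invSuc j * (ι cring (suc j) * (powₚ u j *ₚ θ u) N)) ≈⟨ *-congˡ (invSuc-cancel j _) ⟩
      invFact j * (powₚ u j *ₚ θ u) N                               ∎
    top≈0 : ∀ i → N ≤ i → i < suc N → invFact i * (powₚ u i *ₚ θ u) N ≈ 0#
    top≈0 i N≤i _ = trans (*-congˡ (vanishesBelow-powₚ-θ u≈0 i N (s≤s N≤i))) (zeroʳ _)

  module _ {y : PS} (y≈0 : VanishesBelow 1 y) where

    θ-log1+-expansion : θ (log1+ y) ≈ₚ Σₚ (λ j → scaleₚ (sign j) (powₚ y j *ₚ θ y))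
    θ-log1+-expansion N = begin
      θ (log1+ y) N                                                   ≈⟨ *-congˡ (trans (sumTo-head N _) (+-identityˡ _)) ⟩
      ι cring N * sumTo N (λ j → sign j * invSuc j * powₚ y (suc j) N)  ≈⟨ sumTo-*ˡ N _ _ ⟩
      sumTo N (λ j → ι cring N * (sign j * invSuc j * powₚ y (suc j) N)) ≈⟨ sumTo-cong N (λ j _ → coefficient j) ⟩
      sumTo N (λ j → sign j * Y j N)                                  ≈⟨ sumTo-extend _ (ℕP.n≤1+n N) top≈0 ⟨
      sumTo (suc N) (λ j → sign j * Y j N)                            ∎
      where
      open ≈-Reasoning
      Y : ℕ → PS
      Y j = powₚ y j *ₚ θ y
      coefficient : ∀ j → ι cring N * (sign j * invSuc j * powₚ y (suc j) N) ≈ sign j * Y j N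
      coefficient j = begin
        ι cring N * (sign j * invSuc j * powₚ y (suc j) N)     ≈⟨ *-congˡ (*-assoc _ _ _) ⟩
        ι cring N * (sign j * (invSuc j * powₚ y (suc j) N))   ≈⟨ x*yz≈y*xz _ _ _ ⟩
        sign j * (ι cring N * (invSuc j * powₚ y (suc j) N))   ≈⟨ *-congˡ (x*yz≈y*xz _ _ _) ⟩
        sign j * (invSuc j * θ (powₚ y (suc j)) N)             ≈⟨ *-congˡ (*-congˡ (θ-powₚ y j N)) ⟩
        sign j * (invSuc j * (ι cring (suc j) * Y j N))        ≈⟨ *-congˡ (invSuc-cancel j _) ⟩
        sign j * Y j N                                         ∎
      top≈0 : ∀ i → N ≤ i → i < suc N → sign i * Y i N ≈ 0#
      top≈0 i N≤i _ = trans (*-congˡ (vanishesBelow-powₚ-θ y≈0 i N (s≤s N≤i))) (zeroʳ _)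

    -- log(1 + y)′ = y′ / (1 + y): the series for θ log(1 + y) telescopes against y.
    θ-log1+ : ((oneₚ +ₚ y) *ₚ θ (log1+ y)) ≈ₚ θ y
    θ-log1+ N = begin
      ((oneₚ +ₚ y) *ₚ L) N                                  ≈⟨ *ₚ-distribʳ L oneₚ y N ⟩
      (oneₚ *ₚ L) N + (y *ₚ L) N                            ≈⟨ +-cong (*ₚ-identityˡ L N) (*ₚ-comm y L N) ⟩
      L N + (L *ₚ y) N                                      ≈⟨ +-cong (θ-log1+-expansion N) (*ₚ-congʳ y θ-log1+-expansion N) ⟩
      Σₚ h N + (Σₚ h *ₚ y) N                                ≈⟨ +-congˡ (Σₚ-*ₚ h y h≈0 N) ⟩
      Σₚ h N + Σₚ (λ j → h j *ₚ y) N                        ≈⟨ +-congˡ (sumTo-cong (suc N) (λ j _ → shift j)) ⟩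
      Σₚ h N + sumTo (suc N) (λ j → sign j * Y (suc j) N)   ≈⟨ sumTo-+ (suc N) (λ j → sign j * Y j N) (λ j → sign j * Y (suc j) N) ⟨
      sumTo (suc N) (λ j → sign j * Y j N + sign j * Y (suc j) N)
                                                            ≈⟨ sumTo-cong (suc N) (λ j _ → sym (distribˡ _ _ _)) ⟩
      sumTo (suc N) (λ j → sign j * (Y j N + Y (suc j) N))  ≈⟨ +-identityʳ _ ⟨
      sumTo (suc N) (λ j → sign j * (Y j N + Y (suc j) N)) + 0#
                                                            ≈⟨ +-congˡ (trans (*-congˡ (vanishesBelow-powₚ-θ y≈0 (suc N) N (ℕP.m<n⇒m<1+n ℕP.≤-refl))) (zeroʳ _)) ⟨
      sumTo (suc N) (λ j → sign j * (Y j N + Y (suc j) N)) + sign (suc N) * Y (suc N) N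
                                                            ≈⟨ sumTo-alternating-telescope (suc N) (λ j → Y j N) ⟩
      (oneₚ *ₚ θ y) N                                       ≈⟨ *ₚ-identityˡ (θ y) N ⟩
      θ y N                                                 ∎
      where
      open ≈-Reasoning
      L = θ (log1+ y)
      Y : ℕ → PS
      Y j = powₚ y j *ₚ θ y
      h : ℕ → PS
      h j = scaleₚ (sign j) (Y j)
      h≈0 : ∀ j → VanishesBelow j (h j)
      h≈0 j = vanishesBelow-scaleₚ (sign j) (vanishesBelow-mono (ℕP.n≤1+n j) (vanishesBelow-powₚ-θ y≈0 j))
      shift : ∀ j → (h j *ₚ y) N ≈ sign j * Y (suc j) N
      shift j = trans (scaleₚ-*ₚ (sign j) (Y j) y N)
                      (*-congˡ (trans (*ₚ-comm (Y j) y N) (sym (*ₚ-assoc y (powₚ y j) (θ y) N))))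

  -- The Frobenius operators

  Frob-nonMultiple : ∀ m f {N} → ¬ (m ∣ N) → Frob m f N ≈ 0#
  Frob-nonMultiple m f {N} m∤N with m ∣? N
  ... | yes m∣N = ⊥-elim (m∤N m∣N)
  ... | no _ = refl

  Frob-cong : ∀ m {f g} → f ≈ₚ g → Frob m f ≈ₚ Frob m g
  Frob-cong m f≈g N with m ∣? N
  ... | yes (divides k _) = f≈g k
  ... | no _ = refl

  Frob-scaleₚ : ∀ m a f → Frob m (scaleₚ a f) ≈ₚ scaleₚ a (Frob m f)
  Frob-scaleₚ m a f N with m ∣? N
  ... | yes (divides k _) = refl
  ... | no _ = sym (zeroʳ a)

  θ-Frob : ∀ m f → θ (Frob m f) ≈ₚ scaleₚ (ι cring m) (Frob m (θ f))
  θ-Frob m f N with m ∣? N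
  ... | yes (divides k P.refl) = trans (*-congʳ (trans (ι-* k m) (*-comm _ _))) (*-assoc _ _ _)
  ... | no _ = trans (zeroʳ _) (sym (zeroʳ _))

  module _ (m : ℕ) .{{_ : NonZero m}} where

    Frob-multiple : ∀ f {N} k → N ≡ k ℕ.* m → Frob m f N ≈ f k
    Frob-multiple f k P.refl with m ∣? k ℕ.* m
    ... | yes (divides k′ k*m≡k′*m) = ≡⇒≈ (P.cong f (ℕP.*-cancelʳ-≡ k′ k m (P.sym k*m≡k′*m)))
    ... | no m∤k*m = ⊥-elim (m∤k*m (n∣m*n k))

    Frob-*ₚ-coeff : ∀ f g {N} q r → N ≡ q ℕ.* m ℕ.+ r → r < m →
                    (Frob m f *ₚ g) N ≈ sumTo (suc q) (λ j → f j * g (N ∸ j ℕ.* m))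
    Frob-*ₚ-coeff f g q r P.refl r<m =
      trans (sumTo-multiples m (λ i m∤i → trans (*-congʳ (Frob-nonMultiple m f m∤i)) (zeroˡ _)) q r r<m)
            (sumTo-cong (suc q) (λ j _ → *-congʳ (Frob-multiple f j P.refl)))

    Frob-*ₚ : ∀ f g → Frob m (f *ₚ g) ≈ₚ (Frob m f *ₚ Frob m g)
    -- Not a with-abstraction: that would also rewrite the term Frob m f N inside the right-hand side.
    Frob-*ₚ f g N = byDivisibility (m ∣? N)
      where
      open ≈-Reasoning
      byDivisibility : Dec (m ∣ N) → Frob m (f *ₚ g) N ≈ (Frob m f *ₚ Frob m g) N
      byDivisibility (yes (divides q N≡q*m)) = begin
        Frob m (f *ₚ g) N                                  ≈⟨ Frob-multiple (f *ₚ g) q N≡q*m ⟩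
        (f *ₚ g) q                                         ≈⟨ sumTo-cong (suc q) (λ j _ → *-congˡ (Frob-multiple g (q ∸ j) (N∸j*m j))) ⟨
        sumTo (suc q) (λ j → f j * Frob m g (N ∸ j ℕ.* m)) ≈⟨ Frob-*ₚ-coeff f (Frob m g) q 0 (P.trans N≡q*m (P.sym (ℕP.+-identityʳ _)))
                                                                                  (ℕ.>-nonZero⁻¹ m) ⟨
        (Frob m f *ₚ Frob m g) N                           ∎
        where
        N∸j*m : ∀ j → N ∸ j ℕ.* m ≡ (q ∸ j) ℕ.* m
        N∸j*m j = P.trans (P.cong (_∸ j ℕ.* m) N≡q*m) (P.sym (ℕP.*-distribʳ-∸ m q j))
      byDivisibility (no m∤N) = trans (Frob-nonMultiple m (f *ₚ g) m∤N) (sym (sumTo-zero (suc N) term≈0))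
        where
        term≈0 : ∀ i → i < suc N → Frob m f i * Frob m g (N ∸ i) ≈ 0#
        term≈0 i i≤N with m ∣? i
        ... | yes m∣i = trans (*-congˡ (Frob-nonMultiple m g λ m∣N∸i → m∤N (∣m∸n∣n⇒∣m m (ℕP.≤-pred i≤N) m∣N∸i m∣i)))
                              (zeroʳ _)
        ... | no _ = zeroˡ _

  Frob-Frob : ∀ m n .{{_ : NonZero m}} .{{_ : NonZero n}} f → Frob m (Frob n f) ≈ₚ Frob (m ℕ.* n) f
  Frob-Frob m n f N with m ∣? N
  ... | no m∤N = sym (Frob-nonMultiple (m ℕ.* n) f (m∤N ∘ ∣-trans (m∣m*n n)))
  ... | yes (divides k P.refl) with n ∣? k
  ...   | yes (divides j P.refl) = sym (Frob-multiple (m ℕ.* n) {{ℕP.m*n≢0 m n}} f j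
                                         (P.trans (ℕP.*-assoc j n m) (P.cong (j ℕ.*_) (ℕP.*-comm n m))))
  ...   | no n∤k = sym (Frob-nonMultiple (m ℕ.* n) f mn∤km)
    where
    mn∤km : ¬ (m ℕ.* n ∣ k ℕ.* m)
    mn∤km (divides j k*m≡j*[m*n]) = n∤k (divides j (ℕP.*-cancelʳ-≡ k (j ℕ.* n) m
      (P.trans k*m≡j*[m*n] (P.trans (P.cong (j ℕ.*_) (ℕP.*-comm m n)) (P.sym (ℕP.*-assoc j n m))))))

  -- Quantum numbers and their powers

  qnum-< : ∀ {n N} → N < n → qnum n N ≈ 1#
  qnum-< {n} {N} N<n with N <ᵇ n in N<ᵇn
  ... | true = refl
  ... | false = ⊥-elim (P.subst T N<ᵇn (ℕP.<⇒<ᵇ N<n))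

  qnum-≥ : ∀ {n N} → n ≤ N → qnum n N ≈ 0#
  qnum-≥ {n} {N} n≤N with N <ᵇ n in N<ᵇn
  ... | true = ⊥-elim (ℕP.<⇒≱ (ℕP.<ᵇ⇒< N n (P.subst T (P.sym N<ᵇn) tt)) n≤N)
  ... | false = refl

  qnum-≈ : ∀ {n N n′ N′} → (N < n → N′ < n′) → (N′ < n′ → N < n) → qnum n N ≈ qnum n′ N′
  qnum-≈ {n} {N} to from with N ℕP.<? n
  ... | yes N<n = trans (qnum-< N<n) (sym (qnum-< (to N<n)))
  ... | no N≮n = trans (qnum-≥ (ℕP.≮⇒≥ N≮n)) (sym (qnum-≥ (ℕP.≮⇒≥ (N≮n ∘ from))))

  -- Writing N = q m + r with r < m, only the term j = q of the q^N coefficient survives.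
  qnum-*ₚ-Frob : ∀ m n .{{_ : NonZero m}} → (qnum m *ₚ Frob m (qnum n)) ≈ₚ qnum (m ℕ.* n)
  qnum-*ₚ-Frob m n N = begin
    (qnum m *ₚ Frob m (qnum n)) N                              ≈⟨ *ₚ-comm (qnum m) (Frob m (qnum n)) N ⟩
    (Frob m (qnum n) *ₚ qnum m) N                              ≈⟨ Frob-*ₚ-coeff m (qnum n) (qnum m) q r N≡q*m+r r<m ⟩
    sumTo (suc q) (λ j → qnum n j * qnum m (N ∸ j ℕ.* m))      ≈⟨ sumTo-single (suc q) q _ ℕP.≤-refl others≈0 ⟩
    qnum n q * qnum m (N ∸ q ℕ.* m)                            ≈⟨ *-congˡ (qnum-< (P.subst (_< m) (m%n≡m∸m/n*n N m) r<m)) ⟩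
    qnum n q * 1#                                              ≈⟨ *-identityʳ _ ⟩
    qnum n q                                                   ≈⟨ qnum-≈ q<n⇒N<m*n (m<n*o⇒m/o<n ∘ P.subst (N <_) (ℕP.*-comm m n)) ⟩
    qnum (m ℕ.* n) N                                           ∎
    where
    open ≈-Reasoning
    q = N / m
    r = N % m
    r<m : r < m
    r<m = m%n<n N m
    N≡q*m+r : N ≡ q ℕ.* m ℕ.+ r
    N≡q*m+r = P.trans (m≡m%n+[m/n]*n N m) (ℕP.+-comm r (q ℕ.* m))
    others≈0 : ∀ j → j < suc q → j ≢ q → qnum n j * qnum m (N ∸ j ℕ.* m) ≈ 0#
    others≈0 j j≤q j≢q = trans (*-congˡ (qnum-≥ (ℕP.m+n≤o⇒m≤o∸n m (ℕP.≤-trans (ℕP.*-monoˡ-≤ m j<q) (m/n*n≤m N m)))))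
                               (zeroʳ _)
      where
      j<q : j < q
      j<q = ℕP.≤∧≢⇒< (ℕP.≤-pred j≤q) j≢q
    q<n⇒N<m*n : q < n → N < m ℕ.* n
    q<n⇒N<m*n q<n = P.subst (_< m ℕ.* n) (P.sym (m≡m%n+[m/n]*n N m))
                      (ℕP.<-≤-trans (ℕP.+-monoˡ-< (q ℕ.* m) r<m)
                                    (P.subst (suc q ℕ.* m ≤_) (ℕP.*-comm n m) (ℕP.*-monoˡ-≤ m q<n)))

  -- G behaves like A^t: θG / G = t · θA / A, cleared of denominators.
  record IsPower (t : Carrier) (A G : PS) : Set ℓ where
    constructor isPower
    field θ-equation : (A *ₚ θ G) ≈ₚ scaleₚ t (θ A *ₚ G)

  open IsPower

  -- In the q^N coefficient of A·θG = t·θA·G the coefficient G_N only occurs as N·G_N, since A_0 = 1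
  -- and θA has no constant term; so G is determined by G_0.
  IsPower-unique : ∀ {t A G H} → A 0 ≈ 1# → IsPower t A G → IsPower t A H → G 0 ≈ H 0 → G ≈ₚ H
  IsPower-unique {t} {A} {G} {H} A₀≈1 G-power H-power G₀≈H₀ = <-rec (λ N → G N ≈ H N) step
    where
    open ≈-Reasoning
    recurrence : ∀ {X} → IsPower t A X → ∀ N →
                 sumTo N (λ i → θ X i * A (N ∸ i)) + ι cring N * X N ≈ t * sumTo N (λ i → X i * θ A (N ∸ i))
    recurrence {X} X-power N = begin
      sumTo N (λ i → θ X i * A (N ∸ i)) + ι cring N * X N
        ≈⟨ +-congˡ (trans (sym (*-identityʳ _)) (*-congˡ (sym (trans (≡⇒≈ (P.cong A (ℕP.n∸n≡0 N))) A₀≈1)))) ⟩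
      (θ X *ₚ A) N                                                     ≈⟨ *ₚ-comm (θ X) A N ⟩
      (A *ₚ θ X) N                                                     ≈⟨ θ-equation X-power N ⟩
      t * (θ A *ₚ X) N                                                 ≈⟨ *-congˡ (*ₚ-comm (θ A) X N) ⟩
      t * (sumTo N (λ i → X i * θ A (N ∸ i)) + X N * θ A (N ∸ N))
        ≈⟨ *-congˡ (trans (+-congˡ (trans (*-congˡ (trans (≡⇒≈ (P.cong (θ A) (ℕP.n∸n≡0 N))) (zeroˡ _))) (zeroʳ _))) (+-identityʳ _)) ⟩
      t * sumTo N (λ i → X i * θ A (N ∸ i))                            ∎
    step : ∀ N → (∀ {i} → i < N → G i ≈ H i) → G N ≈ H N
    step zero _ = G₀≈H₀
    step N@(suc M) G≈H = begin
      G N                               ≈⟨ invSuc-cancel M (G N) ⟨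
      invSuc M * (ι cring N * G N)      ≈⟨ *-congˡ (+-cancelˡ _ _ _ sameLower) ⟩
      invSuc M * (ι cring N * H N)      ≈⟨ invSuc-cancel M (H N) ⟩
      H N                               ∎
      where
      sameLower : sumTo N (λ i → θ G i * A (N ∸ i)) + ι cring N * G N ≈ sumTo N (λ i → θ G i * A (N ∸ i)) + ι cring N * H N
      sameLower = begin
        sumTo N (λ i → θ G i * A (N ∸ i)) + ι cring N * G N   ≈⟨ recurrence G-power N ⟩
        t * sumTo N (λ i → G i * θ A (N ∸ i))                 ≈⟨ *-congˡ (sumTo-cong N (λ i i<N → *-congʳ (G≈H i<N))) ⟩
        t * sumTo N (λ i → H i * θ A (N ∸ i))                 ≈⟨ recurrence H-power N ⟨
        sumTo N (λ i → θ H i * A (N ∸ i)) + ι cring N * H N   ≈⟨ +-congʳ (sumTo-cong N (λ i i<N → *-congʳ (*-congˡ (sym (G≈H i<N))))) ⟩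
        sumTo N (λ i → θ G i * A (N ∸ i)) + ι cring N * H N   ∎

  IsPower-congˡ : ∀ {t A A′ G} → A ≈ₚ A′ → IsPower t A G → IsPower t A′ G
  IsPower-congˡ {t} {A} {A′} {G} A≈A′ G-power = isPower
    (≈ₚ-trans (*ₚ-congʳ (θ G) (≈ₚ-sym A≈A′)) (≈ₚ-trans (θ-equation G-power) (scaleₚ-cong t (*ₚ-congʳ G (θ-cong A≈A′)))))

  IsPower-*ₚ : ∀ {t A₁ G₁ A₂ G₂} → IsPower t A₁ G₁ → IsPower t A₂ G₂ → IsPower t (A₁ *ₚ A₂) (G₁ *ₚ G₂)
  IsPower-*ₚ {t} {A₁} {G₁} {A₂} {G₂} G₁-power G₂-power = isPower (begin
    (A₁ *ₚ A₂) *ₚ θ (G₁ *ₚ G₂)                                      ≈⟨ *ₚ-congˡ (A₁ *ₚ A₂) (θ-*ₚ G₁ G₂) ⟩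
    (A₁ *ₚ A₂) *ₚ ((θ G₁ *ₚ G₂) +ₚ (G₁ *ₚ θ G₂))                   ≈⟨ *ₚ-distribˡ (A₁ *ₚ A₂) (θ G₁ *ₚ G₂) (G₁ *ₚ θ G₂) ⟩
    ((A₁ *ₚ A₂) *ₚ (θ G₁ *ₚ G₂)) +ₚ ((A₁ *ₚ A₂) *ₚ (G₁ *ₚ θ G₂)) ≈⟨ +ₚ-cong first second ⟩
    scaleₚ t (Θ₁ *ₚ (G₁ *ₚ G₂)) +ₚ scaleₚ t (Θ₂ *ₚ (G₁ *ₚ G₂))      ≈⟨ scaleₚ-+ₚ t (Θ₁ *ₚ (G₁ *ₚ G₂)) (Θ₂ *ₚ (G₁ *ₚ G₂)) ⟨
    scaleₚ t ((Θ₁ *ₚ (G₁ *ₚ G₂)) +ₚ (Θ₂ *ₚ (G₁ *ₚ G₂)))             ≈⟨ scaleₚ-cong t (*ₚ-distribʳ (G₁ *ₚ G₂) Θ₁ Θ₂) ⟨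
    scaleₚ t ((Θ₁ +ₚ Θ₂) *ₚ (G₁ *ₚ G₂))                             ≈⟨ scaleₚ-cong t (*ₚ-congʳ (G₁ *ₚ G₂) (θ-*ₚ A₁ A₂)) ⟨
    scaleₚ t (θ (A₁ *ₚ A₂) *ₚ (G₁ *ₚ G₂))                           ∎)
    where
    open ≈ₚ-Reasoning
    Θ₁ = θ A₁ *ₚ A₂
    Θ₂ = A₁ *ₚ θ A₂
    first : ((A₁ *ₚ A₂) *ₚ (θ G₁ *ₚ G₂)) ≈ₚ scaleₚ t (Θ₁ *ₚ (G₁ *ₚ G₂))
    first = begin
      (A₁ *ₚ A₂) *ₚ (θ G₁ *ₚ G₂)              ≈⟨ *ₚ-interchange A₁ A₂ (θ G₁) G₂ ⟩
      (A₁ *ₚ θ G₁) *ₚ (A₂ *ₚ G₂)              ≈⟨ *ₚ-congʳ (A₂ *ₚ G₂) (θ-equation G₁-power) ⟩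
      scaleₚ t (θ A₁ *ₚ G₁) *ₚ (A₂ *ₚ G₂)     ≈⟨ scaleₚ-*ₚ t (θ A₁ *ₚ G₁) (A₂ *ₚ G₂) ⟩
      scaleₚ t ((θ A₁ *ₚ G₁) *ₚ (A₂ *ₚ G₂))   ≈⟨ scaleₚ-cong t (*ₚ-interchange (θ A₁) G₁ A₂ G₂) ⟩
      scaleₚ t (Θ₁ *ₚ (G₁ *ₚ G₂))             ∎
    second : ((A₁ *ₚ A₂) *ₚ (G₁ *ₚ θ G₂)) ≈ₚ scaleₚ t (Θ₂ *ₚ (G₁ *ₚ G₂))
    second = begin
      (A₁ *ₚ A₂) *ₚ (G₁ *ₚ θ G₂)              ≈⟨ *ₚ-interchange A₁ A₂ G₁ (θ G₂) ⟩
      (A₁ *ₚ G₁) *ₚ (A₂ *ₚ θ G₂)              ≈⟨ *ₚ-congˡ (A₁ *ₚ G₁) (θ-equation G₂-power) ⟩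
      (A₁ *ₚ G₁) *ₚ scaleₚ t (θ A₂ *ₚ G₂)     ≈⟨ *ₚ-scaleₚ t (A₁ *ₚ G₁) (θ A₂ *ₚ G₂) ⟩
      scaleₚ t ((A₁ *ₚ G₁) *ₚ (θ A₂ *ₚ G₂))   ≈⟨ scaleₚ-cong t (*ₚ-interchange A₁ G₁ (θ A₂) G₂) ⟩
      scaleₚ t (Θ₂ *ₚ (G₁ *ₚ G₂))             ∎

  IsPower-Frob : ∀ m .{{_ : NonZero m}} {t A G} → IsPower t A G → IsPower t (Frob m A) (Frob m G)
  IsPower-Frob m {t} {A} {G} G-power = isPower (begin
    F A *ₚ θ (F G)                          ≈⟨ *ₚ-congˡ (F A) (θ-Frob m G) ⟩
    F A *ₚ scaleₚ ιm (F (θ G))              ≈⟨ *ₚ-scaleₚ ιm (F A) (F (θ G)) ⟩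
    scaleₚ ιm (F A *ₚ F (θ G))              ≈⟨ scaleₚ-cong ιm (Frob-*ₚ m A (θ G)) ⟨
    scaleₚ ιm (F (A *ₚ θ G))                ≈⟨ scaleₚ-cong ιm (Frob-cong m (θ-equation G-power)) ⟩
    scaleₚ ιm (F (scaleₚ t (θ A *ₚ G)))     ≈⟨ scaleₚ-cong ιm (Frob-scaleₚ m t (θ A *ₚ G)) ⟩
    scaleₚ ιm (scaleₚ t (F (θ A *ₚ G)))     ≈⟨ scaleₚ-cong ιm (scaleₚ-cong t (Frob-*ₚ m (θ A) G)) ⟩
    scaleₚ ιm (scaleₚ t (F (θ A) *ₚ F G))   ≈⟨ (λ N → x*yz≈y*xz ιm t _) ⟩
    scaleₚ t (scaleₚ ιm (F (θ A) *ₚ F G))   ≈⟨ scaleₚ-cong t (scaleₚ-*ₚ ιm (F (θ A)) (F G)) ⟨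
    scaleₚ t (scaleₚ ιm (F (θ A)) *ₚ F G)   ≈⟨ scaleₚ-cong t (*ₚ-congʳ (F G) (θ-Frob m A)) ⟨
    scaleₚ t (θ (F A) *ₚ F G)               ∎)
    where
    open ≈ₚ-Reasoning
    F = Frob m
    ιm = ι cring m

  qpow-IsPower : ∀ n .{{_ : NonZero n}} t → IsPower t (qnum n) (qpow n t)
  qpow-IsPower n t = isPower (begin
    qnum n *ₚ θ (expₚ u)                   ≈⟨ *ₚ-congˡ (qnum n) (θ-expₚ u≈0) ⟩
    qnum n *ₚ (P *ₚ θ u)                   ≈⟨ *ₚ-congˡ (qnum n) (*ₚ-congˡ P (θ-scaleₚ t L)) ⟩
    qnum n *ₚ (P *ₚ scaleₚ t (θ L))        ≈⟨ *ₚ-congˡ (qnum n) (*ₚ-scaleₚ t P (θ L)) ⟩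
    qnum n *ₚ scaleₚ t (P *ₚ θ L)          ≈⟨ *ₚ-scaleₚ t (qnum n) (P *ₚ θ L) ⟩
    scaleₚ t (qnum n *ₚ (P *ₚ θ L))        ≈⟨ scaleₚ-cong t (x*ₚyz≈y*ₚxz (qnum n) P (θ L)) ⟩
    scaleₚ t (P *ₚ (qnum n *ₚ θ L))        ≈⟨ scaleₚ-cong t (*ₚ-congˡ P (*ₚ-congʳ (θ L) qnum≈1+y)) ⟩
    scaleₚ t (P *ₚ ((oneₚ +ₚ y) *ₚ θ L))   ≈⟨ scaleₚ-cong t (*ₚ-congˡ P (θ-log1+ y≈0)) ⟩
    scaleₚ t (P *ₚ θ y)                    ≈⟨ scaleₚ-cong t (*ₚ-congˡ P θy≈θqnum) ⟩
    scaleₚ t (P *ₚ θ (qnum n))             ≈⟨ scaleₚ-cong t (*ₚ-comm P (θ (qnum n))) ⟩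
    scaleₚ t (θ (qnum n) *ₚ P)             ∎)
    where
    open ≈ₚ-Reasoning
    y = qnum-1 n
    L = log1+ y
    u = scaleₚ t L
    P = qpow n t
    y≈0 : VanishesBelow 1 y
    y≈0 zero _ = refl
    y≈0 (suc N) (s≤s ())
    u≈0 : VanishesBelow 1 u
    u≈0 zero _ = trans (*-congˡ (+-identityˡ 0#)) (zeroʳ t)
    u≈0 (suc N) (s≤s ())
    qnum≈1+y : qnum n ≈ₚ (oneₚ +ₚ y)
    qnum≈1+y zero = trans (qnum-< (ℕ.>-nonZero⁻¹ n)) (sym (+-identityʳ 1#))
    qnum≈1+y (suc N) = sym (+-identityˡ _)
    θy≈θqnum : θ y ≈ₚ θ (qnum n)
    θy≈θqnum zero = trans (zeroˡ _) (sym (zeroˡ _))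
    θy≈θqnum (suc N) = refl

  qpow-0 : ∀ n t → qpow n t 0 ≈ 1#
  qpow-0 n t = trans (+-identityˡ _) (*-identityˡ _)

  -- Both sides solve the equation characterising [mn]^t and have constant term 1.
  qpow-*ₚ-Frob : ∀ m n .{{_ : NonZero m}} .{{_ : NonZero n}} t →
                 (qpow m t *ₚ Frob m (qpow n t)) ≈ₚ qpow (m ℕ.* n) t
  qpow-*ₚ-Frob m n t = IsPower-unique (qnum-< (ℕ.>-nonZero⁻¹ (m ℕ.* n))) lhs-power (qpow-IsPower (m ℕ.* n) t) constant
    where
    instance
      m*n≢0 : NonZero (m ℕ.* n)
      m*n≢0 = ℕP.m*n≢0 m n
    lhs-power : IsPower t (qnum (m ℕ.* n)) (qpow m t *ₚ Frob m (qpow n t))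
    lhs-power = IsPower-congˡ (qnum-*ₚ-Frob m n) (IsPower-*ₚ (qpow-IsPower m t) (IsPower-Frob m (qpow-IsPower n t)))
    constant : (qpow m t *ₚ Frob m (qpow n t)) 0 ≈ qpow (m ℕ.* n) t 0
    constant = trans (+-identityˡ _)
                     (trans (*-cong (qpow-0 m t) (trans (Frob-multiple m (qpow n t) 0 P.refl) (qpow-0 n t)))
                            (trans (*-identityˡ 1#) (sym (qpow-0 (m ℕ.* n) t))))

  Op-∘ : ∀ s m n .{{_ : NonZero m}} .{{_ : NonZero n}} f → (Op m s ∘ₚ Op n s) f ≈ₚ Op (m ℕ.* n) s f
  Op-∘ s m n f = begin
    qpow m t *ₚ Frob m (qpow n t *ₚ Frob n f)                ≈⟨ *ₚ-congˡ (qpow m t) (Frob-*ₚ m (qpow n t) (Frob n f)) ⟩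
    qpow m t *ₚ (Frob m (qpow n t) *ₚ Frob m (Frob n f))     ≈⟨ *ₚ-assoc (qpow m t) (Frob m (qpow n t)) (Frob m (Frob n f)) ⟨
    (qpow m t *ₚ Frob m (qpow n t)) *ₚ Frob m (Frob n f)     ≈⟨ *ₚ-cong (qpow-*ₚ-Frob m n t) (Frob-Frob m n f) ⟩
    qpow (m ℕ.* n) t *ₚ Frob (m ℕ.* n) f                      ∎
    where
    open ≈ₚ-Reasoning
    t = - s

open import Data.Nat using (_*_)

mainTheorem1 : {c ℓ : Level} (K : CharZeroField c ℓ) →
    let open CharZeroField K using (Carrier) in
    let open PowerSeries K in
    (s : Carrier) (m n : ℕ) → 1 ≤ m → 1 ≤ n →
      ((Op m s ∘ₚ Op n s) ≈op Op (m * n) s)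
      × ((Op m s ∘ₚ Op n s) ≈op (Op n s ∘ₚ Op m s))
-- The composition law holds on all of ℂ[[q]].
mainTheorem1 K s m n 1≤m 1≤n = (λ f _ → Op-∘ K s m n f) , λ f _ → commute f
  where
  open CharZeroField K using (_≈_; trans; sym)
  open PowerSeries K
  instance
    m≢0 : NonZero m
    m≢0 = ℕ.>-nonZero 1≤m
    n≢0 : NonZero n
    n≢0 = ℕ.>-nonZero 1≤n
  commute : ∀ f → (Op m s ∘ₚ Op n s) f ≈ₚ (Op n s ∘ₚ Op m s) f
  commute f N = trans (Op-∘ K s m n f N)
                      (P.subst (λ k → Op k s f N ≈ (Op n s ∘ₚ Op m s) f N) (ℕP.*-comm n m) (sym (Op-∘ K s n m f N)))
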